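{- Let $n\ge 1$ and $k>1$ be integers, and define a binary operation $+_\star$ on $\mathbb{F}_{2^n}\times\mathbb{Z}_{2^k}$ by $$(x_1,y_1)+_\star(x_2,y_2)=\bigl(x_1+x_2,\; y_1+y_2+2^{k-1}\mathrm{Tr}^n_1(x_1x_2)\bigr).$$ Then $G=(\mathbb{F}_{2^n}\times\mathbb{Z}_{2^k},+_\star)$ is a group, and it is isomorphic to $\mathbb{Z}_2^{n}\times\mathbb{Z}_{2^k}$.
   Context: $\mathrm{Tr}^n_1(x)=\sum_{i=0}^{n-1}x^{2^i}$ is the absolute trace from $\mathbb{F}_{2^n}$ to $\mathbb{F}_2$; its value in $\{0,1\}$ is regarded as an integer when multiplied by $2^{k-1}$ in $\mathbb{Z}_{2^k}$. -}

module Defs where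

open import Level using (Level; _⊔_) renaming (suc to lsuc)
open import Data.Nat using (ℕ; zero; suc; _∸_; _^_; NonZero)
import Data.Nat as ℕ
open import Data.Nat.Properties using (m^n≢0)
open import Data.Nat.DivMod using (_mod_)
open import Data.Fin using (Fin; toℕ)
open import Data.Vec using (Vec; zipWith; replicate; map)
open import Data.Product using (_×_; _,_; proj₁; proj₂; Σ)
open import Relation.Nullary using (¬_; Dec; yes; no)
open import Relation.Binary.PropositionalEquality as ≡ using (_≡_)
open import Relation.Binary.Core using (Rel)
open import Function.Bundles using (Bijection)
open import Algebra.Bundles using (CommutativeRing)
open import Algebra.Bundles.Raw using (RawGroup)
open import Data.Fin using (_≟_)

record IsFiniteFieldOfSize {c ℓ} (R : CommutativeRing c ℓ) (m : ℕ) : Set (c ⊔ ℓ) where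
  open CommutativeRing R
  field
    1≉0     : ¬ (1# ≈ 0#)
    inverse : ∀ x → ¬ (x ≈ 0#) → Σ Carrier (λ y → (x * y) ≈ 1#)
    enum    : Bijection setoid (≡.setoid (Fin m))

module FF {c ℓ} (R : CommutativeRing c ℓ) {m : ℕ} (isF : IsFiniteFieldOfSize R m) where
  open CommutativeRing R
  open IsFiniteFieldOfSize isF
  open Bijection enum using (to)

  pow : Carrier → ℕ → Carrier
  pow x zero    = 1#
  pow x (suc e) = x * pow x e

  Tr : ℕ → Carrier → Carrier
  Tr zero    x = 0#
  Tr (suc i) x = Tr i x + pow x (2 ^ i)

addMod : (m : ℕ) .{{_ : NonZero m}} → Fin m → Fin m → Fin m
addMod m i j = (toℕ i ℕ.+ toℕ j) mod m

negMod : (m : ℕ) .{{_ : NonZero m}} → Fin m → Fin m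
negMod m i = (m ∸ toℕ i) mod m

zeroMod : (m : ℕ) .{{_ : NonZero m}} → Fin m
zeroMod m = 0 mod m

Z2^ : ℕ → Set
Z2^ k = Fin (2 ^ k)

addZ : ∀ k → Z2^ k → Z2^ k → Z2^ k
addZ k = addMod (2 ^ k) {{m^n≢0 2 k}}

half : ∀ k → Z2^ k
half k = (2 ^ (k ∸ 1)) mod (2 ^ k) where instance _ = m^n≢0 2 k

module Star {c ℓ} (n k : ℕ) (R : CommutativeRing c ℓ)
            (isF : IsFiniteFieldOfSize R (2 ^ n)) where
  open CommutativeRing R
  open IsFiniteFieldOfSize isF
  open Bijection enum using (to)
  open FF R isF

  Carrierᴳ : Set c
  Carrierᴳ = Carrier × Z2^ k

  -- 2^(k-1) · Tr(x) ∈ Z_{2^k}, with Tr(x) ∈ F_2 = {0,1} read as an integer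
  trTerm : Carrier → Z2^ k
  trTerm x with to (Tr n x) ≟ to 0#
  ... | yes _ = zeroMod (2 ^ k) {{m^n≢0 2 k}}
  ... | no  _ = half k

  _+⋆_ : Carrierᴳ → Carrierᴳ → Carrierᴳ
  (x₁ , y₁) +⋆ (x₂ , y₂) = (x₁ + x₂ , addZ k (addZ k y₁ y₂) (trTerm (x₁ * x₂)))

  _≈ᴳ_ : Rel Carrierᴳ ℓ
  (x₁ , y₁) ≈ᴳ (x₂ , y₂) = (x₁ ≈ x₂) × (y₁ ≡ y₂)

  rawG : Carrierᴳ → (Carrierᴳ → Carrierᴳ) → RawGroup c ℓ
  rawG e inv = record { Carrier = Carrierᴳ ; _≈_ = _≈ᴳ_ ; _∙_ = _+⋆_ ; ε = e ; _⁻¹ = inv }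

Z2nZ2k : ℕ → ℕ → RawGroup Level.zero Level.zero
Z2nZ2k n k = record
  { Carrier = Vec (Fin 2) n × Z2^ k
  ; _≈_     = _≡_
  ; _∙_     = λ a b → zipWith (addMod 2) (proj₁ a) (proj₁ b) , addZ k (proj₂ a) (proj₂ b)
  ; ε       = replicate n (zeroMod 2) , zeroMod (2 ^ k) {{m^n≢0 2 k}}
  ; _⁻¹     = λ a → map (negMod 2) (proj₁ a) , negMod (2 ^ k) {{m^n≢0 2 k}} (proj₂ a)
  }

{-# OPTIONS --safe #-}
-- The map β x y = 2^(k-1) Tr(x y) is biadditive: the trace is additive and, by Fermat's little
-- theorem x ^ 2^n = x, takes only the values 0 and 1. So +⋆ is the product of (F, +) and ℤ/2^k
-- twisted by the symmetric bilinear cocycle β, which makes G = (F × ℤ/2^k, +⋆) an abelian group.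
-- Choose an F₂-basis e₁ … eₙ of F and, using k ≥ 2, halves hᵢ ∈ {0, 2^(k-2)} of β eᵢ eᵢ. The lifts
-- (eᵢ , hᵢ) have order 2 in G, so their products define Q : F → ℤ/2^k with
-- Q (x + y) = Q x + Q y + β x y, and (x , y) ↦ (coordinates of x , y - Q x) is an isomorphism
-- G ≅ ℤ₂ⁿ × ℤ/2^k.
module Submission where

open import Defs
open import Level using (Level; _⊔_)
open import Data.Nat as ℕ using (ℕ; _≤_; _<_; _^_; _∸_; _%_; NonZero)
import Data.Nat.Properties as ℕ
open import Data.Nat.Properties using (m^n≢0)
open import Data.Nat.DivMod using (_mod_; %-distribˡ-+; n%n≡0; m*n%n≡0; m<n⇒m%n≡m; m%n<n)
open import Data.Fin as Fin using (Fin; toℕ; zero; suc)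
open import Data.Fin.Properties
  using (toℕ<n; fromℕ<-toℕ; toℕ-fromℕ<; fromℕ<-cong; remQuot-combine; combine-remQuot;
         injective⇒≤; any?; all?; ¬∀⟶∃¬; punchInᵢ≢i)
open import Data.Fin.Permutation using (Permutation; permutation; _⟨$⟩ʳ_)
open import Data.Vec using (Vec; []; _∷_; zipWith; replicate; map)
open import Data.Vec.Functional as Vec using (Vector; removeAt)
open import Data.Vec.Relation.Unary.All as All using (All; []; _∷_)
import Data.Vec.Relation.Unary.All.Properties as All
open import Data.Product using (Σ; ∃; _×_; _,_; proj₁; proj₂)
open import Data.Sum using (_⊎_; inj₁; inj₂; [_,_]′)
open import Data.Empty using (⊥-elim)
open import Function using (_∘_; id)
open import Function.Bundles using (Bijection; Inverse)
open import Function.Properties.Bijection using (Bijection⇒Inverse)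
open import Relation.Nullary using (¬_; Dec; yes; no)
import Relation.Nullary.Decidable as Dec
open import Relation.Binary.PropositionalEquality as ≡ using (_≡_; _≢_)
import Relation.Binary.Reasoning.Setoid
open import Algebra.Bundles using (AbelianGroup; CommutativeMonoid; CommutativeRing)
open import Algebra.Bundles.Raw using (RawGroup)
open import Algebra.Structures using (IsGroup)
open import Algebra.Morphism.Structures using (module GroupMorphisms)
import Algebra.Properties.CommutativeMonoid.Sum
import Algebra.Properties.Monoid.Mult
import Algebra.Properties.Semiring.Exp

-- Every law is transported from ℕ along i ≡ toℕ i mod m (mod-toℕ) and the additivity of _mod m.
module IntegersMod (m : ℕ) .{{_ : NonZero m}} where
  open ≡.≡-Reasoning

  infixl 6 _⊕_
  _⊕_ : Fin m → Fin m → Fin m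
  _⊕_ = addMod m

  mod-cong : ∀ {a b} → a % m ≡ b % m → a mod m ≡ b mod m
  mod-cong eq = fromℕ<-cong _ _ eq _ _

  mod-toℕ : ∀ i → toℕ i mod m ≡ i
  mod-toℕ i = ≡.trans (fromℕ<-cong _ _ (m<n⇒m%n≡m (toℕ<n i)) _ (toℕ<n i)) (fromℕ<-toℕ i (toℕ<n i))

  toℕ-mod : ∀ a → toℕ (a mod m) ≡ a % m
  toℕ-mod a = toℕ-fromℕ< (m%n<n a m)

  mod-+ : ∀ a b → a mod m ⊕ b mod m ≡ (a ℕ.+ b) mod m
  mod-+ a b = mod-cong (begin
    (toℕ (a mod m) ℕ.+ toℕ (b mod m)) % m  ≡⟨ ≡.cong₂ (λ u v → (u ℕ.+ v) % m) (toℕ-mod a) (toℕ-mod b) ⟩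
    (a % m ℕ.+ b % m) % m                  ≡⟨ %-distribˡ-+ a b m ⟨
    (a ℕ.+ b) % m                          ∎)

  mod-double : ∀ a → a mod m ⊕ a mod m ≡ (2 ℕ.* a) mod m
  mod-double a = ≡.trans (mod-+ a a) (≡.cong (λ b → (a ℕ.+ b) mod m) (≡.sym (ℕ.+-identityʳ a)))

  mod-self : m mod m ≡ zeroMod m
  mod-self = mod-cong (≡.trans (n%n≡0 m) (≡.sym (m*n%n≡0 0 m)))

  ⊕-assoc : ∀ i j l → (i ⊕ j) ⊕ l ≡ i ⊕ (j ⊕ l)
  ⊕-assoc i j l = begin
    (toℕ i ℕ.+ toℕ j) mod m ⊕ l                ≡⟨ ≡.cong (i ⊕ j ⊕_) (mod-toℕ l) ⟨
    (toℕ i ℕ.+ toℕ j) mod m ⊕ toℕ l mod m      ≡⟨ mod-+ _ _ ⟩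
    (toℕ i ℕ.+ toℕ j ℕ.+ toℕ l) mod m          ≡⟨ ≡.cong (_mod m) (ℕ.+-assoc (toℕ i) _ _) ⟩
    (toℕ i ℕ.+ (toℕ j ℕ.+ toℕ l)) mod m        ≡⟨ mod-+ _ _ ⟨
    toℕ i mod m ⊕ (toℕ j ℕ.+ toℕ l) mod m      ≡⟨ ≡.cong (_⊕ (j ⊕ l)) (mod-toℕ i) ⟩
    i ⊕ (j ⊕ l)                                ∎

  ⊕-comm : ∀ i j → i ⊕ j ≡ j ⊕ i
  ⊕-comm i j = ≡.cong (_mod m) (ℕ.+-comm (toℕ i) (toℕ j))

  ⊕-identityˡ : ∀ i → zeroMod m ⊕ i ≡ i
  ⊕-identityˡ i = begin
    zeroMod m ⊕ i          ≡⟨ ≡.cong (zeroMod m ⊕_) (mod-toℕ i) ⟨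
    0 mod m ⊕ toℕ i mod m  ≡⟨ mod-+ 0 (toℕ i) ⟩
    toℕ i mod m            ≡⟨ mod-toℕ i ⟩
    i                      ∎

  ⊕-inverseˡ : ∀ i → negMod m i ⊕ i ≡ zeroMod m
  ⊕-inverseˡ i = begin
    (m ∸ toℕ i) mod m ⊕ i            ≡⟨ ≡.cong ((m ∸ toℕ i) mod m ⊕_) (mod-toℕ i) ⟨
    (m ∸ toℕ i) mod m ⊕ toℕ i mod m  ≡⟨ mod-+ _ _ ⟩
    (m ∸ toℕ i ℕ.+ toℕ i) mod m      ≡⟨ ≡.cong (_mod m) (ℕ.m∸n+n≡m (ℕ.<⇒≤ (toℕ<n i))) ⟩
    m mod m                          ≡⟨ mod-self ⟩
    zeroMod m                        ∎

  +-abelianGroup : AbelianGroup Level.zero Level.zero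
  +-abelianGroup = record
    { _≈_ = _≡_
    ; _∙_ = _⊕_
    ; ε   = zeroMod m
    ; _⁻¹ = negMod m
    ; isAbelianGroup = record
      { isGroup = record
        { isMonoid = record
          { isSemigroup = record
            { isMagma = record { isEquivalence = ≡.isEquivalence ; ∙-cong = ≡.cong₂ _⊕_ }
            ; assoc   = ⊕-assoc }
          ; identity = ⊕-identityˡ , λ i → ≡.trans (⊕-comm i _) (⊕-identityˡ i) }
        ; inverse = ⊕-inverseˡ , λ i → ≡.trans (⊕-comm i _) (⊕-inverseˡ i)
        ; ⁻¹-cong = ≡.cong (negMod m) }
      ; comm = ⊕-comm } }

ℤ/2^ : ℕ → AbelianGroup Level.zero Level.zero
ℤ/2^ k = IntegersMod.+-abelianGroup (2 ^ k) {{m^n≢0 2 k}}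

half-double : ∀ i →
  addZ (ℕ.suc i) (half (ℕ.suc i)) (half (ℕ.suc i)) ≡ zeroMod (2 ^ ℕ.suc i) {{m^n≢0 2 (ℕ.suc i)}}
half-double i = ≡.trans (mod-double (2 ^ i)) mod-self
  where open IntegersMod (2 ^ ℕ.suc i) {{m^n≢0 2 (ℕ.suc i)}}

quarter : ∀ j → Z2^ (ℕ.suc (ℕ.suc j))
quarter j = (2 ^ j) mod (2 ^ ℕ.suc (ℕ.suc j)) where instance _ = m^n≢0 2 (ℕ.suc (ℕ.suc j))

quarter-double : ∀ j → addZ (ℕ.suc (ℕ.suc j)) (quarter j) (quarter j) ≡ half (ℕ.suc (ℕ.suc j))
quarter-double j = mod-double (2 ^ j)
  where open IntegersMod (2 ^ ℕ.suc (ℕ.suc j)) {{m^n≢0 2 (ℕ.suc (ℕ.suc j))}}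

module _ {c ℓ} (A : AbelianGroup c ℓ) where
  open AbelianGroup A
  open import Algebra.Properties.AbelianGroup A using (⁻¹-∙-comm)
  open import Algebra.Properties.CommutativeSemigroup commutativeSemigroup using (interchange)

  -‿interchange : ∀ a b c d → (a ∙ b) - (c ∙ d) ≈ (a - c) ∙ (b - d)
  -‿interchange a b c d = trans (∙-congˡ (sym (⁻¹-∙-comm c d))) (interchange a b (c ⁻¹) (d ⁻¹))

module _ {c₁ ℓ₁ c₂ ℓ₂} (V : AbelianGroup c₁ ℓ₁) (A : AbelianGroup c₂ ℓ₂) where
  private module V = AbelianGroup V
  open AbelianGroup A
  open import Algebra.Properties.AbelianGroup A using (identityˡ-unique; inverseʳ-unique)

  record IsBiadditive (β : V.Carrier → V.Carrier → Carrier) : Set (c₁ ⊔ ℓ₁ ⊔ ℓ₂) where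
    field
      cong  : ∀ {x x′ y y′} → x V.≈ x′ → y V.≈ y′ → β x y ≈ β x′ y′
      homoˡ : ∀ x y z → β (x V.∙ y) z ≈ β x z ∙ β y z
      homoʳ : ∀ x y z → β x (y V.∙ z) ≈ β x y ∙ β x z

    ε-homoˡ : ∀ y → β V.ε y ≈ ε
    ε-homoˡ y = identityˡ-unique _ _ (trans (sym (homoˡ V.ε V.ε y)) (cong (V.identityˡ V.ε) V.refl))

    ε-homoʳ : ∀ x → β x V.ε ≈ ε
    ε-homoʳ x = identityˡ-unique _ _ (trans (sym (homoʳ x V.ε V.ε)) (cong V.refl (V.identityˡ V.ε)))

    ⁻¹-homoˡ : ∀ x y → β (x V.⁻¹) y ≈ β x y ⁻¹
    ⁻¹-homoˡ x y = inverseʳ-unique _ _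
      (trans (sym (homoˡ x (x V.⁻¹) y)) (trans (cong (V.inverseʳ x) V.refl) (ε-homoˡ y)))

    ⁻¹-homoʳ : ∀ x y → β x (y V.⁻¹) ≈ β x y ⁻¹
    ⁻¹-homoʳ x y = inverseʳ-unique _ _
      (trans (sym (homoʳ x y (y V.⁻¹))) (trans (cong V.refl (V.inverseʳ y)) (ε-homoʳ x)))

module TwistedProduct {c₁ ℓ₁ c₂ ℓ₂} (V : AbelianGroup c₁ ℓ₁) (A : AbelianGroup c₂ ℓ₂)
    {β : AbelianGroup.Carrier V → AbelianGroup.Carrier V → AbelianGroup.Carrier A}
    (β-biadditive : IsBiadditive V A β) where
  private module V = AbelianGroup V
  open AbelianGroup A
  open IsBiadditive β-biadditive renaming (cong to β-cong)
  open import Algebra.Properties.Monoid monoid using (cancelˡ)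
  open import Algebra.Solver.CommutativeMonoid commutativeMonoid using (solve; _⊜_; _⊕_)
  open import Relation.Binary.Reasoning.Setoid setoid

  Carrier⋆ : Set (c₁ ⊔ c₂)
  Carrier⋆ = V.Carrier × Carrier

  infix 4 _≈⋆_
  _≈⋆_ : Carrier⋆ → Carrier⋆ → Set (ℓ₁ ⊔ ℓ₂)
  (x₁ , y₁) ≈⋆ (x₂ , y₂) = (x₁ V.≈ x₂) × (y₁ ≈ y₂)

  infixl 7 _⋆_
  _⋆_ : Carrier⋆ → Carrier⋆ → Carrier⋆
  (x₁ , y₁) ⋆ (x₂ , y₂) = (x₁ V.∙ x₂ , y₁ ∙ y₂ ∙ β x₁ x₂)

  ε⋆ : Carrier⋆
  ε⋆ = (V.ε , ε)

  infix 8 _⁻¹⋆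
  _⁻¹⋆ : Carrier⋆ → Carrier⋆
  (x , y) ⁻¹⋆ = (x V.⁻¹ , y ⁻¹ ∙ β x x)

  ⋆-assoc : ∀ p q r → (p ⋆ q) ⋆ r ≈⋆ p ⋆ (q ⋆ r)
  ⋆-assoc (x₁ , y₁) (x₂ , y₂) (x₃ , y₃) = V.assoc x₁ x₂ x₃ , (begin
    y₁ ∙ y₂ ∙ β x₁ x₂ ∙ y₃ ∙ β (x₁ V.∙ x₂) x₃         ≈⟨ ∙-congˡ (homoˡ x₁ x₂ x₃) ⟩
    y₁ ∙ y₂ ∙ β x₁ x₂ ∙ y₃ ∙ (β x₁ x₃ ∙ β x₂ x₃)     ≈⟨ rearrange y₁ y₂ y₃ (β x₁ x₂) (β x₁ x₃) (β x₂ x₃) ⟩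
    y₁ ∙ (y₂ ∙ y₃ ∙ β x₂ x₃) ∙ (β x₁ x₂ ∙ β x₁ x₃)  ≈⟨ ∙-congˡ (homoʳ x₁ x₂ x₃) ⟨
    y₁ ∙ (y₂ ∙ y₃ ∙ β x₂ x₃) ∙ β x₁ (x₂ V.∙ x₃)      ∎)
    where
    rearrange = solve 6 (λ a b c p r s → (((a ⊕ b) ⊕ p) ⊕ c) ⊕ (r ⊕ s) ⊜ (a ⊕ ((b ⊕ c) ⊕ s)) ⊕ (p ⊕ r)) refl

  ⋆-identityˡ : ∀ p → ε⋆ ⋆ p ≈⋆ p
  ⋆-identityˡ (x , y) = V.identityˡ x , trans (∙-cong (identityˡ y) (ε-homoˡ x)) (identityʳ y)

  ⋆-identityʳ : ∀ p → p ⋆ ε⋆ ≈⋆ p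
  ⋆-identityʳ (x , y) = V.identityʳ x , trans (∙-cong (identityʳ y) (ε-homoʳ x)) (identityʳ y)

  ⋆-inverseˡ : ∀ p → p ⁻¹⋆ ⋆ p ≈⋆ ε⋆
  ⋆-inverseˡ (x , y) = V.inverseˡ x , (begin
    y ⁻¹ ∙ β x x ∙ y ∙ β (x V.⁻¹) x   ≈⟨ ∙-congˡ (⁻¹-homoˡ x x) ⟩
    y ⁻¹ ∙ β x x ∙ y ∙ β x x ⁻¹       ≈⟨ rearrange (y ⁻¹) (β x x) y (β x x ⁻¹) ⟩
    y ⁻¹ ∙ y ∙ (β x x ∙ β x x ⁻¹)     ≈⟨ ∙-cong (inverseˡ y) (inverseʳ (β x x)) ⟩
    ε ∙ ε                             ≈⟨ identityˡ ε ⟩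
    ε                                 ∎)
    where rearrange = solve 4 (λ a b c d → ((a ⊕ b) ⊕ c) ⊕ d ⊜ (a ⊕ c) ⊕ (b ⊕ d)) refl

  ⋆-inverseʳ : ∀ p → p ⋆ p ⁻¹⋆ ≈⋆ ε⋆
  ⋆-inverseʳ (x , y) = V.inverseʳ x , (begin
    y ∙ (y ⁻¹ ∙ β x x) ∙ β x (x V.⁻¹)  ≈⟨ ∙-cong (cancelˡ (inverseʳ y) (β x x)) (⁻¹-homoʳ x x) ⟩
    β x x ∙ β x x ⁻¹                   ≈⟨ inverseʳ (β x x) ⟩
    ε                                  ∎)

  ⋆-isGroup : IsGroup _≈⋆_ _⋆_ ε⋆ _⁻¹⋆
  ⋆-isGroup = record
    { isMonoid = record
      { isSemigroup = record
        { isMagma = record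
          { isEquivalence = record
            { refl  = V.refl , refl
            ; sym   = λ (x₁≈x₂ , y₁≈y₂) → V.sym x₁≈x₂ , sym y₁≈y₂
            ; trans = λ (x₁≈x₂ , y₁≈y₂) (x₂≈x₃ , y₂≈y₃) → V.trans x₁≈x₂ x₂≈x₃ , trans y₁≈y₂ y₂≈y₃ }
          ; ∙-cong = λ (x₁≈x₂ , y₁≈y₂) (x₁′≈x₂′ , y₁′≈y₂′) →
              V.∙-cong x₁≈x₂ x₁′≈x₂′ , ∙-cong (∙-cong y₁≈y₂ y₁′≈y₂′) (β-cong x₁≈x₂ x₁′≈x₂′) }
        ; assoc = ⋆-assoc }
      ; identity = ⋆-identityˡ , ⋆-identityʳ }
    ; inverse = ⋆-inverseˡ , ⋆-inverseʳ
    ; ⁻¹-cong = λ (x₁≈x₂ , y₁≈y₂) → V.⁻¹-cong x₁≈x₂ , ∙-cong (⁻¹-cong y₁≈y₂) (β-cong x₁≈x₂ x₁≈x₂) }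

  ⋆-rawGroup : RawGroup (c₁ ⊔ c₂) (ℓ₁ ⊔ ℓ₂)
  ⋆-rawGroup = record { _≈_ = _≈⋆_ ; _∙_ = _⋆_ ; ε = ε⋆ ; _⁻¹ = _⁻¹⋆ }

  ⋆-abelianGroup : (∀ x y → β x y ≈ β y x) → AbelianGroup (c₁ ⊔ c₂) (ℓ₁ ⊔ ℓ₂)
  ⋆-abelianGroup β-sym = record
    { isAbelianGroup = record
      { isGroup = ⋆-isGroup
      ; comm    = λ (x₁ , y₁) (x₂ , y₂) → V.comm x₁ x₂ , ∙-cong (comm y₁ y₂) (β-sym x₁ x₂) } }

infixl 6 _⊞_
_⊞_ : ∀ {d} → Vec (Fin 2) d → Vec (Fin 2) d → Vec (Fin 2) d
_⊞_ = zipWith (addMod 2)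

map-negMod-2-id : ∀ {d} (c : Vec (Fin 2) d) → map (negMod 2) c ≡ c
map-negMod-2-id []             = ≡.refl
map-negMod-2-id (zero ∷ c)     = ≡.cong (zero ∷_) (map-negMod-2-id c)
map-negMod-2-id (suc zero ∷ c) = ≡.cong (suc zero ∷_) (map-negMod-2-id c)

encode : ∀ {d} → Vec (Fin 2) d → Fin (2 ^ d)
encode []      = zero
encode (b ∷ c) = Fin.combine b (encode c)

decode : ∀ d → Fin (2 ^ d) → Vec (Fin 2) d
decode ℕ.zero    _ = []
decode (ℕ.suc d) i = proj₁ (Fin.remQuot {2} (2 ^ d) i) ∷ decode d (proj₂ (Fin.remQuot {2} (2 ^ d) i))

decode-encode : ∀ {d} (c : Vec (Fin 2) d) → decode d (encode c) ≡ c
decode-encode []                = ≡.refl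
decode-encode {ℕ.suc d} (b ∷ c) = ≡.trans
  (≡.cong (λ (b′ , i) → b′ ∷ decode d i) (remQuot-combine {k = 2 ^ d} b (encode c)))
  (≡.cong (b ∷_) (decode-encode c))

encode-decode : ∀ d i → encode (decode d i) ≡ i
encode-decode ℕ.zero    zero = ≡.refl
encode-decode (ℕ.suc d) i    =
  ≡.trans (≡.cong (Fin.combine b) (encode-decode d j)) (combine-remQuot {2} (2 ^ d) i)
  where
  b = proj₁ (Fin.remQuot {2} (2 ^ d) i)
  j = proj₂ (Fin.remQuot {2} (2 ^ d) i)

module Combinations {c ℓ} (G : AbelianGroup c ℓ) where
  open AbelianGroup G
  open import Algebra.Properties.CommutativeSemigroup commutativeSemigroup using (interchange)

  infixr 8 _·_
  _·_ : Fin 2 → Carrier → Carrier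
  zero     · g = ε
  suc zero · g = g

  combination : ∀ {d} → Vec Carrier d → Vec (Fin 2) d → Carrier
  combination []       []      = ε
  combination (g ∷ gs) (b ∷ c) = b · g ∙ combination gs c

  ·-homo : ∀ {g} → g ∙ g ≈ ε → ∀ b b′ → addMod 2 b b′ · g ≈ b · g ∙ b′ · g
  ·-homo g∙g≈ε zero       zero       = sym (identityˡ ε)
  ·-homo g∙g≈ε zero       (suc zero) = sym (identityˡ _)
  ·-homo g∙g≈ε (suc zero) zero       = sym (identityʳ _)
  ·-homo g∙g≈ε (suc zero) (suc zero) = sym g∙g≈ε

  combination-zeros : ∀ {d} (gs : Vec Carrier d) → combination gs (replicate d zero) ≈ ε
  combination-zeros []       = refl
  combination-zeros (g ∷ gs) = trans (identityˡ _) (combination-zeros gs)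

  combination-homo : ∀ {d} {gs : Vec Carrier d} → All (λ g → g ∙ g ≈ ε) gs →
                     ∀ c c′ → combination gs (c ⊞ c′) ≈ combination gs c ∙ combination gs c′
  combination-homo []             []      []        = sym (identityˡ ε)
  combination-homo (g∙g≈ε ∷ gs²) (b ∷ c) (b′ ∷ c′) =
    trans (∙-cong (·-homo g∙g≈ε b b′) (combination-homo gs² c c′)) (interchange _ _ _ _)

record IsElementaryOfOrder2^ {c ℓ} (V : AbelianGroup c ℓ) (n : ℕ) : Set (c ⊔ ℓ) where
  open AbelianGroup V
  field
    x∙x≈ε : ∀ x → x ∙ x ≈ ε
    enum  : Bijection setoid (≡.setoid (Fin (2 ^ n)))

module Coordinates {c ℓ} (V : AbelianGroup c ℓ) {n : ℕ} (elementary : IsElementaryOfOrder2^ V n) where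
  open AbelianGroup V
  open IsElementaryOfOrder2^ elementary
  open Combinations V public
  open Bijection enum using (to; injective) renaming (cong to to-cong)
  open Inverse (Bijection⇒Inverse enum) using (from; strictlyInverseˡ; strictlyInverseʳ)
  open import Algebra.Properties.Group group using (∙-cancelˡ)
  open import Relation.Binary.Reasoning.Setoid setoid

  _≟_ : ∀ x y → Dec (x ≈ y)
  x ≟ y = Dec.map′ injective to-cong (to x Fin.≟ to y)

  combination-⊞ : ∀ {d} (es : Vec Carrier d) c c′ →
                  combination es (c ⊞ c′) ≈ combination es c ∙ combination es c′
  combination-⊞ es = combination-homo (All.universal x∙x≈ε es)

  Independent : ∀ {d} → Vec Carrier d → Set ℓ
  Independent es = ∀ {c c′} → combination es c ≈ combination es c′ → c ≡ c′

  Spanning : ∀ {d} → Vec Carrier d → Set (c ⊔ ℓ)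
  Spanning es = ∀ x → ∃ λ c → combination es c ≈ x

  infix 4 _∉⟨_⟩
  _∉⟨_⟩ : ∀ {d} → Carrier → Vec Carrier d → Set ℓ
  x ∉⟨ es ⟩ = ∀ c → ¬ combination es c ≈ x

  independent⇒2^d≤2^n : ∀ {d} {es : Vec Carrier d} → Independent es → 2 ^ d ≤ 2 ^ n
  independent⇒2^d≤2^n {d} {es} independent = injective⇒≤ {f = λ i → to (combination es (decode d i))}
    λ {i} {j} eq → ≡.trans (≡.sym (encode-decode d i))
                           (≡.trans (≡.cong encode (independent (injective eq))) (encode-decode d j))

  spanning⇒2^n≤2^d : ∀ {d} {es : Vec Carrier d} → Spanning es → 2 ^ n ≤ 2 ^ d
  spanning⇒2^n≤2^d {d} {es} spanning = injective⇒≤ {f = encode ∘ coefficients}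
    λ {i} {j} eq → ≡.trans (≡.sym (strictlyInverseˡ i)) (≡.trans (to-cong (begin
      from i                            ≈⟨ proj₂ (spanning (from i)) ⟨
      combination es (coefficients i)   ≡⟨ ≡.cong (combination es) (encode-injective eq) ⟩
      combination es (coefficients j)   ≈⟨ proj₂ (spanning (from j)) ⟩
      from j                            ∎)) (strictlyInverseˡ j))
    where
    coefficients = λ i → proj₁ (spanning (from i))
    encode-injective : ∀ {c c′ : Vec (Fin 2) d} → encode c ≡ encode c′ → c ≡ c′
    encode-injective eq = ≡.trans (≡.sym (decode-encode _)) (≡.trans (≡.cong (decode d) eq) (decode-encode _))

  spanning? : ∀ {d} (es : Vec Carrier d) → Spanning es ⊎ ∃ (_∉⟨ es ⟩)
  spanning? {d} es with all? (λ i → any? (λ j → combination es (decode d j) ≟ from i))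
  ... | yes hit = inj₁ λ x → let (j , eq) = hit (to x) in decode d j , trans eq (strictlyInverseʳ x)
  ... | no ¬hit =
    let (i , miss) = ¬∀⟶∃¬ _ _ (λ i → any? (λ j → combination es (decode d j) ≟ from i)) ¬hit in
    inj₂ (from i , λ c eq →
      miss (encode c , trans (reflexive (≡.cong (combination es) (decode-encode c))) eq))

  private
    ∈span : ∀ {d} (es : Vec Carrier d) {x} c c′ → ε ∙ combination es c ≈ x ∙ combination es c′ →
            combination es (c ⊞ c′) ≈ x
    ∈span es {x} c c′ eq = begin
      combination es (c ⊞ c′)                          ≈⟨ combination-⊞ es c c′ ⟩
      combination es c ∙ combination es c′             ≈⟨ ∙-congʳ (identityˡ _) ⟨
      ε ∙ combination es c ∙ combination es c′         ≈⟨ ∙-congʳ eq ⟩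
      x ∙ combination es c′ ∙ combination es c′        ≈⟨ assoc _ _ _ ⟩
      x ∙ (combination es c′ ∙ combination es c′)      ≈⟨ ∙-congˡ (x∙x≈ε _) ⟩
      x ∙ ε                                            ≈⟨ identityʳ x ⟩
      x                                                ∎

  independent-∷ : ∀ {d} {es : Vec Carrier d} {x} → x ∉⟨ es ⟩ → Independent es → Independent (x ∷ es)
  independent-∷ x∉ independent {zero ∷ c} {zero ∷ c′} eq =
    ≡.cong (zero ∷_) (independent (∙-cancelˡ ε _ _ eq))
  independent-∷ x∉ independent {suc zero ∷ c} {suc zero ∷ c′} eq =
    ≡.cong (suc zero ∷_) (independent (∙-cancelˡ _ _ _ eq))
  independent-∷ {es = es} x∉ independent {zero ∷ c} {suc zero ∷ c′} eq =
    ⊥-elim (x∉ (c ⊞ c′) (∈span es c c′ eq))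
  independent-∷ {es = es} x∉ independent {suc zero ∷ c} {zero ∷ c′} eq =
    ⊥-elim (x∉ (c′ ⊞ c) (∈span es c′ c (sym eq)))

  Basis : Set (c ⊔ ℓ)
  Basis = Σ (Vec Carrier n) λ es → Independent es × Spanning es

  private
    1<2 : 1 < 2
    1<2 = ℕ.s≤s (ℕ.s≤s ℕ.z≤n)

    -- r counts the vectors still to be adjoined. By counting (2 ^ d ≤ 2 ^ n for independent,
    -- 2 ^ n ≤ 2 ^ d for spanning families) the family spans exactly when d = n.
    extendToBasis : ∀ r {d} (es : Vec Carrier d) → r ℕ.+ d ≡ n → Independent es → Basis
    extendToBasis r es eq independent with spanning? es
    extendToBasis ℕ.zero    es ≡.refl independent | inj₁ spanning = es , independent , spanning
    extendToBasis (ℕ.suc r) {d} es eq independent | inj₁ spanning = ⊥-elim (ℕ.<⇒≱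
      (ℕ.^-monoʳ-< 2 1<2 (≡.subst (d <_) eq (ℕ.m<n+m d ℕ.z<s))) (spanning⇒2^n≤2^d {es = es} spanning))
    extendToBasis ℕ.zero    es ≡.refl independent | inj₂ (x , x∉) = ⊥-elim (ℕ.<⇒≱
      (ℕ.^-monoʳ-< 2 1<2 (ℕ.n<1+n n))
      (independent⇒2^d≤2^n {es = x ∷ es} (independent-∷ {es = es} x∉ independent)))
    extendToBasis (ℕ.suc r) es eq independent | inj₂ (x , x∉) =
      extendToBasis r (x ∷ es) (≡.trans (ℕ.+-suc r _) eq) (independent-∷ {es = es} x∉ independent)

  -- Opaque: type checking terms built from coords would otherwise unfold the search, which is very slow.
  opaque
    basis : Basis
    basis = extendToBasis n [] (ℕ.+-identityʳ n) λ { {[]} {[]} _ → ≡.refl }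

  base : Vec Carrier n
  base = proj₁ basis

  coords : Carrier → Vec (Fin 2) n
  coords x = proj₁ (proj₂ (proj₂ basis) x)

  combination-coords : ∀ x → combination base (coords x) ≈ x
  combination-coords x = proj₂ (proj₂ (proj₂ basis) x)

  combination-injective : ∀ {c c′} → combination base c ≈ combination base c′ → c ≡ c′
  combination-injective = proj₁ (proj₂ basis)

  coords-injective : ∀ {x y} → coords x ≡ coords y → x ≈ y
  coords-injective {x} {y} eq =
    trans (sym (combination-coords x))
          (trans (reflexive (≡.cong (combination base) eq)) (combination-coords y))

  coords-combination : ∀ c → coords (combination base c) ≡ c
  coords-combination c = combination-injective (combination-coords _)

  coords-cong : ∀ {x y} → x ≈ y → coords x ≡ coords y
  coords-cong {x} {y} x≈y =
    combination-injective (trans (combination-coords x) (trans x≈y (sym (combination-coords y))))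

  coords-homo : ∀ x y → coords (x ∙ y) ≡ coords x ⊞ coords y
  coords-homo x y = combination-injective (begin
    combination base (coords (x ∙ y))
      ≈⟨ combination-coords (x ∙ y) ⟩
    x ∙ y
      ≈⟨ ∙-cong (combination-coords x) (combination-coords y) ⟨
    combination base (coords x) ∙ combination base (coords y)
      ≈⟨ combination-⊞ base (coords x) (coords y) ⟨
    combination base (coords x ⊞ coords y)
      ∎)

module QuadraticRefinement {c ℓ a ℓᵃ} (V : AbelianGroup c ℓ) {n : ℕ} (elementary : IsElementaryOfOrder2^ V n)
    (A : AbelianGroup a ℓᵃ)
    {β : AbelianGroup.Carrier V → AbelianGroup.Carrier V → AbelianGroup.Carrier A}
    (β-biadditive : IsBiadditive V A β)
    (β-sym : ∀ x y → AbelianGroup._≈_ A (β x y) (β y x))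
    (h : AbelianGroup.Carrier V → AbelianGroup.Carrier A)
    (h-double : ∀ x → AbelianGroup._≈_ A (AbelianGroup._∙_ A (h x) (h x)) (β x x)) where
  open AbelianGroup V
  open IsElementaryOfOrder2^ elementary using (x∙x≈ε)
  open Coordinates V elementary
  open IsBiadditive β-biadditive renaming (cong to β-cong)
  open TwistedProduct V A β-biadditive
  private
    module A where
      open AbelianGroup A public
      open import Algebra.Properties.AbelianGroup A public using (identityˡ-unique; inverseˡ-unique)
    module ≃-Reasoning = Relation.Binary.Reasoning.Setoid (AbelianGroup.setoid A)
    module G = Combinations (⋆-abelianGroup β-sym)
  open A using () renaming (_∙_ to _⊕_; ε to 𝟎; _≈_ to _≃_)

  β-order2 : ∀ x y → β x y ⊕ β x y ≃ 𝟎
  β-order2 x y = A.trans (A.sym (homoˡ x x y)) (A.trans (β-cong (x∙x≈ε x) refl) (ε-homoˡ y))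

  lift : Carrier → Carrier⋆
  lift x = x , h x

  lift-order2 : ∀ x → lift x ⋆ lift x ≈⋆ ε⋆
  lift-order2 x = x∙x≈ε x , A.trans (A.∙-congʳ (h-double x)) (β-order2 x x)

  combination-lifts : ∀ {d} (es : Vec Carrier d) c → proj₁ (G.combination (map lift es) c) ≡ combination es c
  combination-lifts []       []             = ≡.refl
  combination-lifts (x ∷ es) (zero ∷ c)     = ≡.cong (ε ∙_) (combination-lifts es c)
  combination-lifts (x ∷ es) (suc zero ∷ c) = ≡.cong (x ∙_) (combination-lifts es c)

  -- Since ⋆ is commutative and the lifts have order 2, c ↦ G.combination (map lift base) c is
  -- additive; the A-component of that identity is Q-homo.
  Q : Vec (Fin 2) n → A.Carrier
  Q c = proj₂ (G.combination (map lift base) c)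

  Q-homo : ∀ c c′ → Q (c ⊞ c′) ≃ Q c ⊕ Q c′ ⊕ β (combination base c) (combination base c′)
  Q-homo c c′ = A.trans
    (proj₂ (G.combination-homo (All.map⁺ (All.universal lift-order2 base)) c c′))
    (A.reflexive (≡.cong₂ (λ u v → Q c ⊕ Q c′ ⊕ β u v)
                          (combination-lifts base c) (combination-lifts base c′)))

  q : Carrier → A.Carrier
  q x = Q (coords x)

  q-cong : ∀ {x y} → x ≈ y → q x ≡ q y
  q-cong x≈y = ≡.cong Q (coords-cong x≈y)

  q-homo : ∀ x y → q (x ∙ y) ≃ q x ⊕ q y ⊕ β x y
  q-homo x y = begin
    Q (coords (x ∙ y))       ≡⟨ ≡.cong Q (coords-homo x y) ⟩
    Q (coords x ⊞ coords y)  ≈⟨ Q-homo (coords x) (coords y) ⟩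
    q x ⊕ q y ⊕ β (combination base (coords x)) (combination base (coords y))
                             ≈⟨ A.∙-congˡ (β-cong (combination-coords x) (combination-coords y)) ⟩
    q x ⊕ q y ⊕ β x y        ∎
    where open ≃-Reasoning

  q-ε : q ε ≃ 𝟎
  q-ε = A.identityˡ-unique (q ε) (q ε) (begin
    q ε ⊕ q ε          ≈⟨ A.identityʳ _ ⟨
    q ε ⊕ q ε ⊕ 𝟎      ≈⟨ A.∙-congˡ (ε-homoˡ ε) ⟨
    q ε ⊕ q ε ⊕ β ε ε  ≈⟨ q-homo ε ε ⟨
    q (ε ∙ ε)          ≡⟨ q-cong (identityˡ ε) ⟩
    q ε                ∎)
    where open ≃-Reasoning

  q-double : ∀ x → q x ⊕ q x ≃ β x x
  q-double x = A.trans (A.inverseˡ-unique _ _ qqβ≈𝟎) (A.sym (A.inverseˡ-unique _ _ (β-order2 x x)))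
    where
    qqβ≈𝟎 : q x ⊕ q x ⊕ β x x ≃ 𝟎
    qqβ≈𝟎 = A.trans (A.sym (q-homo x x)) (A.trans (A.reflexive (q-cong (x∙x≈ε x))) q-ε)

module Splitting {c ℓ} (V : AbelianGroup c ℓ) {n : ℕ} (elementary : IsElementaryOfOrder2^ V n) (k : ℕ)
    {β : AbelianGroup.Carrier V → AbelianGroup.Carrier V → Z2^ k} (β-biadditive : IsBiadditive V (ℤ/2^ k) β)
    (β-sym : ∀ x y → β x y ≡ β y x)
    (h : AbelianGroup.Carrier V → Z2^ k) (h-double : ∀ x → addZ k (h x) (h x) ≡ β x x) where
  open AbelianGroup V hiding (_-_)
  open IsElementaryOfOrder2^ elementary using (x∙x≈ε)
  open Coordinates V elementary
  open QuadraticRefinement V elementary (ℤ/2^ k) β-biadditive β-sym h h-double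
  open TwistedProduct V (ℤ/2^ k) β-biadditive
  open import Algebra.Properties.AbelianGroup V using (inverseʳ-unique)
  private
    module Z where
      open AbelianGroup (ℤ/2^ k) public
      open import Algebra.Properties.AbelianGroup (ℤ/2^ k) public
      open import Algebra.Properties.Monoid (AbelianGroup.monoid (ℤ/2^ k)) public using (cancelʳ)
  open Z using () renaming (_∙_ to _⊕_; ε to 𝟎; _⁻¹ to infix 8 -_; _-_ to _⊖_)
  open RawGroup (Z2nZ2k n k) using () renaming (_∙_ to _∙ᵗ_; ε to εᵗ; _⁻¹ to _⁻¹ᵗ)
  open ≡.≡-Reasoning

  φ : Carrier⋆ → Vec (Fin 2) n × Z2^ k
  φ (x , y) = coords x , y ⊖ q x

  φ-cong : ∀ {p p′} → p ≈⋆ p′ → φ p ≡ φ p′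
  φ-cong (x≈x′ , y≡y′) = ≡.cong₂ _,_ (coords-cong x≈x′) (≡.cong₂ _⊖_ y≡y′ (q-cong x≈x′))

  φ-homo : ∀ p p′ → φ (p ⋆ p′) ≡ φ p ∙ᵗ φ p′
  φ-homo (x , y) (x′ , y′) = ≡.cong₂ _,_ (coords-homo x x′) (begin
    (y ⊕ y′ ⊕ β x x′) ⊖ q (x ∙ x′)
      ≡⟨ ≡.cong ((y ⊕ y′ ⊕ β x x′) ⊖_) (q-homo x x′) ⟩
    (y ⊕ y′ ⊕ β x x′) ⊖ (q x ⊕ q x′ ⊕ β x x′)
      ≡⟨ -‿interchange (ℤ/2^ k) (y ⊕ y′) (β x x′) (q x ⊕ q x′) (β x x′) ⟩
    ((y ⊕ y′) ⊖ (q x ⊕ q x′)) ⊕ (β x x′ ⊖ β x x′)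
      ≡⟨ ≡.cong₂ _⊕_ (-‿interchange (ℤ/2^ k) y y′ (q x) (q x′)) (Z.inverseʳ (β x x′)) ⟩
    (y ⊖ q x) ⊕ (y′ ⊖ q x′) ⊕ 𝟎
      ≡⟨ Z.identityʳ _ ⟩
    (y ⊖ q x) ⊕ (y′ ⊖ q x′)
      ∎)

  φ-ε-homo : φ ε⋆ ≡ εᵗ
  φ-ε-homo = ≡.cong₂ _,_
    (combination-injective (trans (combination-coords ε) (sym (combination-zeros base))))
    (≡.trans (≡.cong (𝟎 ⊖_) q-ε) (Z.inverseʳ 𝟎))

  φ-⁻¹-homo : ∀ p → φ (p ⁻¹⋆) ≡ φ p ⁻¹ᵗ
  φ-⁻¹-homo (x , y) = ≡.cong₂ _,_
    (≡.trans (coords-cong (sym x≈x⁻¹)) (≡.sym (map-negMod-2-id (coords x)))) (begin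
    (- y ⊕ β x x) ⊖ q (x ⁻¹)    ≡⟨ ≡.cong₂ (λ b r → (- y ⊕ b) ⊖ r) (q-double x) (q-cong x≈x⁻¹) ⟨
    (- y ⊕ (q x ⊕ q x)) ⊖ q x   ≡⟨ Z.assoc _ _ _ ⟩
    - y ⊕ ((q x ⊕ q x) ⊖ q x)   ≡⟨ ≡.cong (- y ⊕_) (Z.cancelʳ (Z.inverseʳ (q x)) (q x)) ⟩
    - y ⊕ q x                   ≡⟨ Z.comm (- y) (q x) ⟩
    q x ⊖ y                     ≡⟨ Z.⁻¹-anti-homo‿- y (q x) ⟨
    - (y ⊖ q x)                 ∎)
    where
    x≈x⁻¹ : x ≈ x ⁻¹
    x≈x⁻¹ = inverseʳ-unique x x (x∙x≈ε x)

  φ-injective : ∀ {p p′} → φ p ≡ φ p′ → p ≈⋆ p′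
  φ-injective {x , y} {x′ , y′} eq = coords-injective coords≡ , Z.∙-cancelʳ (- q x) y y′ (begin
    y ⊖ q x    ≡⟨ ≡.cong proj₂ eq ⟩
    y′ ⊖ q x′  ≡⟨ ≡.cong (λ c → y′ ⊖ Q c) coords≡ ⟨
    y′ ⊖ q x   ∎)
    where
    coords≡ = ≡.cong proj₁ eq

  φ-surjective : ∀ t → ∃ λ p → ∀ {p′} → p′ ≈⋆ p → φ p′ ≡ t
  φ-surjective (c , z) = (combination base c , z ⊕ Q c) , λ { {x , y} (x≈ , y≡) →
    ≡.cong₂ _,_ (coords≡ x≈) (begin
      y ⊖ Q (coords x)  ≡⟨ ≡.cong₂ (λ u c′ → u ⊖ Q c′) y≡ (coords≡ x≈) ⟩
      (z ⊕ Q c) ⊖ Q c   ≡⟨ Z.cancelʳ (Z.inverseʳ (Q c)) z ⟩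
      z                 ∎) }
    where
    coords≡ : ∀ {x} → x ≈ combination base c → coords x ≡ c
    coords≡ x≈ = ≡.trans (coords-cong x≈) (coords-combination c)

  φ-isGroupIsomorphism : GroupMorphisms.IsGroupIsomorphism ⋆-rawGroup (Z2nZ2k n k) φ
  φ-isGroupIsomorphism = record
    { isGroupMonomorphism = record
      { isGroupHomomorphism = record
        { isMonoidHomomorphism = record
          { isMagmaHomomorphism = record
            { isRelHomomorphism = record { cong = φ-cong }
            ; homo = φ-homo }
          ; ε-homo = φ-ε-homo }
        ; ⁻¹-homo = φ-⁻¹-homo }
      ; injective = φ-injective }
    ; surjective = φ-surjective }

module _ {c ℓ} (M : CommutativeMonoid c ℓ) where
  open CommutativeMonoid M
  open import Algebra.Properties.CommutativeMonoid.Sum M using (sum; sum-remove; sum-cong-≋; sum-replicate)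
  open import Algebra.Definitions.RawMonoid rawMonoid using () renaming (_×_ to _·_)
  open import Relation.Binary.Reasoning.Setoid setoid

  sum-constant-except : ∀ {N} (t : Vector Carrier N) z {a} → t z ≈ ε → (∀ i → i ≢ z → t i ≈ a) →
                        sum t ∙ a ≈ N · a
  sum-constant-except {ℕ.suc N} t z {a} tz≈ε t≈a = begin
    sum t ∙ a                        ≈⟨ ∙-congʳ (sum-remove t) ⟩
    t z ∙ sum (removeAt t z) ∙ a     ≈⟨ ∙-congʳ (∙-cong tz≈ε (sum-cong-≋ λ j → t≈a _ (punchInᵢ≢i z j))) ⟩
    ε ∙ sum (Vec.replicate N a) ∙ a  ≈⟨ ∙-congʳ (trans (identityˡ _) (sum-replicate N)) ⟩
    N · a ∙ a                        ≈⟨ comm _ a ⟩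
    a ∙ N · a                        ∎

module FiniteField {c ℓ} (F : CommutativeRing c ℓ) {m : ℕ} (isF : IsFiniteFieldOfSize F m) where
  open CommutativeRing F hiding (zero)
  open IsFiniteFieldOfSize isF
  open Bijection enum using (to; injective) renaming (cong to to-cong)
  open Inverse (Bijection⇒Inverse enum) using (from; strictlyInverseˡ; strictlyInverseʳ)
  open FF F isF using (pow)
  private module E = Algebra.Properties.Semiring.Exp semiring
  open import Relation.Binary.Reasoning.Setoid setoid
  private module Π = Algebra.Properties.CommutativeMonoid.Sum *-commutativeMonoid

  _≟_ : ∀ x y → Dec (x ≈ y)
  x ≟ y = Dec.map′ injective to-cong (to x Fin.≟ to y)

  *-cancelˡ : ∀ {a x y} → ¬ a ≈ 0# → a * x ≈ a * y → x ≈ y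
  *-cancelˡ {a} {x} {y} a≉0 ax≈ay = begin
    x               ≈⟨ *-identityˡ x ⟨
    1# * x          ≈⟨ *-congʳ ba≈1 ⟨
    b * a * x       ≈⟨ *-assoc b a x ⟩
    b * (a * x)     ≈⟨ *-congˡ ax≈ay ⟩
    b * (a * y)     ≈⟨ *-assoc b a y ⟨
    b * a * y       ≈⟨ *-congʳ ba≈1 ⟩
    1# * y          ≈⟨ *-identityˡ y ⟩
    y               ∎
    where
    b = proj₁ (inverse a a≉0)
    ba≈1 = trans (*-comm b a) (proj₂ (inverse a a≉0))

  *-nonzero : ∀ {a b} → ¬ a ≈ 0# → ¬ b ≈ 0# → ¬ a * b ≈ 0#
  *-nonzero a≉0 b≉0 ab≈0 = b≉0 (*-cancelˡ a≉0 (trans ab≈0 (sym (zeroʳ _))))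

  product-nonzero : ∀ {N} (t : Vector Carrier N) → (∀ i → ¬ t i ≈ 0#) → ¬ Π.sum t ≈ 0#
  product-nonzero {ℕ.zero}  t t≉0 = 1≉0
  product-nonzero {ℕ.suc N} t t≉0 = *-nonzero (t≉0 zero) (product-nonzero (Vec.tail t) (t≉0 ∘ suc))

  private
    unlessZero : Carrier → Carrier → Carrier
    unlessZero x a with x ≟ 0#
    ... | yes _ = 1#
    ... | no  _ = a

    unlessZero-≈0 : ∀ {x} a → x ≈ 0# → unlessZero x a ≈ 1#
    unlessZero-≈0 {x} a x≈0 with x ≟ 0#
    ... | yes _   = refl
    ... | no x≉0 = ⊥-elim (x≉0 x≈0)

    unlessZero-≉0 : ∀ {x} a → ¬ x ≈ 0# → unlessZero x a ≈ a
    unlessZero-≉0 {x} a x≉0 with x ≟ 0#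
    ... | yes x≈0 = ⊥-elim (x≉0 x≈0)
    ... | no _    = refl

    unlessZero-nonzero : ∀ x → ¬ unlessZero x x ≈ 0#
    unlessZero-nonzero x with x ≟ 0#
    ... | yes _   = 1≉0
    ... | no x≉0 = x≉0

    unlessZero-cong : ∀ {x y} → x ≈ y → unlessZero x x ≈ unlessZero y y
    unlessZero-cong {x} {y} x≈y = [ x≈0⇒ , x≉0⇒ ]′ (Dec.toSum (x ≟ 0#))
      where
      x≈0⇒ : x ≈ 0# → unlessZero x x ≈ unlessZero y y
      x≈0⇒ x≈0 = trans (unlessZero-≈0 x x≈0) (sym (unlessZero-≈0 y (trans (sym x≈y) x≈0)))
      x≉0⇒ : ¬ x ≈ 0# → unlessZero x x ≈ unlessZero y y
      x≉0⇒ x≉0 = trans (unlessZero-≉0 x x≉0) (trans x≈y (sym (unlessZero-≉0 y (x≉0 ∘ trans x≈y))))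

    unlessZero-* : ∀ {a} x → ¬ a ≈ 0# → unlessZero (a * x) (a * x) ≈ unlessZero x a * unlessZero x x
    unlessZero-* {a} x a≉0 with x ≟ 0#
    ... | yes x≈0 = trans (unlessZero-≈0 _ (trans (*-congˡ x≈0) (zeroʳ a))) (sym (*-identityˡ 1#))
    ... | no x≉0  = unlessZero-≉0 _ (*-nonzero a≉0 x≉0)

    0#^ : ∀ {N} → Fin N → pow 0# N ≈ 0#
    0#^ {ℕ.suc N} _ = zeroˡ _

  pow≡^ : ∀ x e → pow x e ≡ x E.^ e
  pow≡^ x ℕ.zero    = ≡.refl
  pow≡^ x (ℕ.suc e) = ≡.cong (x *_) (pow≡^ x e)

  pow-cong : ∀ e {x y} → x ≈ y → pow x e ≈ pow y e
  pow-cong e {x} {y} x≈y =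
    trans (reflexive (pow≡^ x e)) (trans (E.^-congˡ e x≈y) (reflexive (≡.sym (pow≡^ y e))))

  private
    scale : ∀ {a b} → a * b ≈ 1# → ∀ i → to (a * from (to (b * from i))) ≡ i
    scale {a} {b} ab≈1 i = ≡.trans (to-cong (begin
      a * from (to (b * from i))  ≈⟨ *-congˡ (strictlyInverseʳ _) ⟩
      a * (b * from i)            ≈⟨ *-assoc a b _ ⟨
      a * b * from i              ≈⟨ *-congʳ ab≈1 ⟩
      1# * from i                 ≈⟨ *-identityˡ _ ⟩
      from i                      ∎)) (strictlyInverseˡ i)

    scaling : ∀ {x} → ¬ x ≈ 0# → Permutation m m
    scaling {x} x≉0 = permutation (λ i → to (x * from i)) (λ i → to (y * from i))
                                  (scale xy≈1) (scale (trans (*-comm y x) xy≈1))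
      where
      y = proj₁ (inverse x x≉0)
      xy≈1 = proj₂ (inverse x x≉0)

    -- Compare Π unlessZero y y over all y with the same product after the permutation y ↦ x * y.
    product-unlessZero : ∀ {x} → ¬ x ≈ 0# → Π.sum (λ i → unlessZero (from i) x) ≈ 1#
    product-unlessZero {x} x≉0 = *-cancelˡ (product-nonzero u (unlessZero-nonzero ∘ from)) (begin
      Π.sum u * Π.sum w                       ≈⟨ *-comm _ _ ⟩
      Π.sum w * Π.sum u                       ≈⟨ Π.∑-distrib-+ w u ⟨
      Π.sum (λ i → w i * u i)                 ≈⟨ Π.sum-cong-≋ u∘scaling≈w*u ⟨
      Π.sum (λ i → u (scaling x≉0 ⟨$⟩ʳ i))    ≈⟨ Π.sum-permute u (scaling x≉0) ⟨
      Π.sum u                                 ≈⟨ *-identityʳ _ ⟨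
      Π.sum u * 1#                            ∎)
      where
      w u : Vector Carrier m
      w i = unlessZero (from i) x
      u i = unlessZero (from i) (from i)
      u∘scaling≈w*u : ∀ i → u (scaling x≉0 ⟨$⟩ʳ i) ≈ w i * u i
      u∘scaling≈w*u i = trans (unlessZero-cong (strictlyInverseʳ _)) (unlessZero-* (from i) x≉0)

  fermat : ∀ x → pow x m ≈ x
  fermat x with x ≟ 0#
  ... | yes x≈0 = trans (pow-cong m x≈0) (trans (0#^ (to 0#)) (sym x≈0))
  ... | no x≉0  = begin
    pow x m               ≡⟨ pow≡^ x m ⟩
    x E.^ m               ≈⟨ sum-constant-except *-commutativeMonoid w (to 0#) w₀≈1 w≈x ⟨
    Π.sum w * x           ≈⟨ *-congʳ (product-unlessZero x≉0) ⟩
    1# * x                ≈⟨ *-identityˡ x ⟩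
    x                     ∎
    where
    w : Vector Carrier m
    w i = unlessZero (from i) x

    w₀≈1 : w (to 0#) ≈ 1#
    w₀≈1 = unlessZero-≈0 x (strictlyInverseʳ 0#)

    w≈x : ∀ i → i ≢ to 0# → w i ≈ x
    w≈x i i≢0 = unlessZero-≉0 x λ i≈0 → i≢0 (≡.trans (≡.sym (strictlyInverseˡ i)) (to-cong i≈0))

module Trace {c ℓ} (F : CommutativeRing c ℓ) (n : ℕ) (isF : IsFiniteFieldOfSize F (2 ^ ℕ.suc n)) where
  open CommutativeRing F hiding (zero)
  open FF F isF using (pow; Tr)
  open FiniteField F isF using (_≟_; *-cancelˡ; pow≡^; pow-cong; fermat)
  open import Algebra.Properties.Ring ring using (-1*x≈-x; -‿involutive)
  open import Algebra.Properties.Group +-group using () renaming (∙-cancelʳ to +-cancelʳ)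
  open import Algebra.Properties.CommutativeSemigroup +-commutativeSemigroup using (interchange; xy∙z≈xz∙y)
  open import Relation.Binary.Reasoning.Setoid setoid
  private
    module E = Algebra.Properties.Semiring.Exp semiring
    module M = Algebra.Properties.Monoid.Mult *-monoid

  -1≈1 : - 1# ≈ 1#
  -1≈1 = begin
    - 1#                          ≈⟨ fermat (- 1#) ⟨
    pow (- 1#) (2 ℕ.* 2 ^ n)      ≡⟨ pow≡^ (- 1#) (2 ℕ.* 2 ^ n) ⟩
    (- 1#) E.^ (2 ℕ.* 2 ^ n)      ≈⟨ E.^-assocʳ (- 1#) 2 (2 ^ n) ⟨
    ((- 1#) E.^ 2) E.^ 2 ^ n      ≈⟨ E.^-congˡ (2 ^ n) [-1]²≈1 ⟩
    1# E.^ 2 ^ n                  ≈⟨ M.×-idem (*-identityˡ 1#) (2 ^ n) {{m^n≢0 2 n}} ⟩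
    1#                            ∎
    where
    [-1]²≈1 : (- 1#) E.^ 2 ≈ 1#
    [-1]²≈1 = trans (*-congˡ (*-identityʳ _)) (trans (-1*x≈-x _) (-‿involutive 1#))

  x+x≈0 : ∀ x → x + x ≈ 0#
  x+x≈0 x = begin
    x + x             ≈⟨ +-congˡ (trans (sym (*-identityˡ x)) (trans (*-congʳ (sym -1≈1)) (-1*x≈-x x))) ⟩
    x + - x           ≈⟨ -‿inverseʳ x ⟩
    0#                ∎

  +-elementary : IsElementaryOfOrder2^ +-abelianGroup (ℕ.suc n)
  +-elementary = record { x∙x≈ε = x+x≈0 ; enum = IsFiniteFieldOfSize.enum isF }

  square-+ : ∀ x y → (x + y) * (x + y) ≈ x * x + y * y
  square-+ x y = begin
    (x + y) * (x + y)                   ≈⟨ distribʳ (x + y) x y ⟩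
    x * (x + y) + y * (x + y)           ≈⟨ +-cong (distribˡ x x y) (trans (distribˡ y x y) (+-comm _ _)) ⟩
    (x * x + x * y) + (y * y + y * x)   ≈⟨ interchange _ _ _ _ ⟩
    (x * x + y * y) + (x * y + y * x)   ≈⟨ +-congˡ (trans (+-congˡ (*-comm y x)) (x+x≈0 (x * y))) ⟩
    (x * x + y * y) + 0#                ≈⟨ +-identityʳ _ ⟩
    x * x + y * y                       ∎

  frobenius : ℕ → Carrier → Carrier
  frobenius i x = pow x (2 ^ i)

  frobenius-suc : ∀ i x → frobenius (ℕ.suc i) x ≈ frobenius i x * frobenius i x
  frobenius-suc i x = begin
    pow x (2 ^ i ℕ.+ (2 ^ i ℕ.+ 0))      ≡⟨ pow≡^ x (2 ^ ℕ.suc i) ⟩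
    x E.^ (2 ^ i ℕ.+ (2 ^ i ℕ.+ 0))      ≈⟨ E.^-homo-* x (2 ^ i) _ ⟩
    x E.^ 2 ^ i * x E.^ (2 ^ i ℕ.+ 0)    ≡⟨ ≡.cong (λ b → x E.^ 2 ^ i * x E.^ b) (ℕ.+-identityʳ (2 ^ i)) ⟩
    x E.^ 2 ^ i * x E.^ 2 ^ i            ≡⟨ ≡.cong₂ _*_ (pow≡^ x (2 ^ i)) (pow≡^ x (2 ^ i)) ⟨
    frobenius i x * frobenius i x        ∎

  frobenius-+ : ∀ i x y → frobenius i (x + y) ≈ frobenius i x + frobenius i y
  frobenius-+ ℕ.zero    x y = distribʳ 1# x y
  frobenius-+ (ℕ.suc i) x y = begin
    frobenius (ℕ.suc i) (x + y)
      ≈⟨ frobenius-suc i (x + y) ⟩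
    frobenius i (x + y) * frobenius i (x + y)
      ≈⟨ *-cong (frobenius-+ i x y) (frobenius-+ i x y) ⟩
    (frobenius i x + frobenius i y) * (frobenius i x + frobenius i y)
      ≈⟨ square-+ _ _ ⟩
    frobenius i x * frobenius i x + frobenius i y * frobenius i y
      ≈⟨ +-cong (frobenius-suc i x) (frobenius-suc i y) ⟨
    frobenius (ℕ.suc i) x + frobenius (ℕ.suc i) y
      ∎

  Tr-cong : ∀ i {x y} → x ≈ y → Tr i x ≈ Tr i y
  Tr-cong ℕ.zero    x≈y = refl
  Tr-cong (ℕ.suc i) x≈y = +-cong (Tr-cong i x≈y) (pow-cong (2 ^ i) x≈y)

  Tr-+ : ∀ i x y → Tr i (x + y) ≈ Tr i x + Tr i y
  Tr-+ ℕ.zero    x y = sym (+-identityˡ 0#)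
  Tr-+ (ℕ.suc i) x y = trans (+-cong (Tr-+ i x y) (frobenius-+ i x y)) (interchange _ _ _ _)

  Tr-square : ∀ i x → Tr i x * Tr i x + x ≈ Tr i x + frobenius i x
  Tr-square ℕ.zero    x = +-cong (zeroˡ 0#) (sym (*-identityʳ x))
  Tr-square (ℕ.suc i) x = begin
    (Tr i x + frobenius i x) * (Tr i x + frobenius i x) + x
      ≈⟨ +-congʳ (square-+ _ _) ⟩
    Tr i x * Tr i x + frobenius i x * frobenius i x + x
      ≈⟨ xy∙z≈xz∙y _ _ _ ⟩
    Tr i x * Tr i x + x + frobenius i x * frobenius i x
      ≈⟨ +-cong (Tr-square i x) (sym (frobenius-suc i x)) ⟩
    Tr i x + frobenius i x + frobenius (ℕ.suc i) x
      ∎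

  Tr-idempotent : ∀ x → Tr (ℕ.suc n) x * Tr (ℕ.suc n) x ≈ Tr (ℕ.suc n) x
  Tr-idempotent x = +-cancelʳ x _ _ (trans (Tr-square (ℕ.suc n) x) (+-congˡ (fermat x)))

  Tr-0or1 : ∀ x → Tr (ℕ.suc n) x ≈ 0# ⊎ Tr (ℕ.suc n) x ≈ 1#
  Tr-0or1 x with Tr (ℕ.suc n) x ≟ 0#
  ... | yes T≈0 = inj₁ T≈0
  ... | no T≉0  = inj₂ (*-cancelˡ T≉0 (trans (Tr-idempotent x) (sym (*-identityʳ _))))

module TraceForm {c ℓ} (F : CommutativeRing c ℓ) (n : ℕ) (isF : IsFiniteFieldOfSize F (2 ^ ℕ.suc n))
                 (j : ℕ) where
  open CommutativeRing F hiding (zero)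
  open IsFiniteFieldOfSize isF using (1≉0; enum)
  open Bijection enum using (to; injective) renaming (cong to to-cong)
  open FF F isF using (Tr)
  open FiniteField F isF using (_≟_)
  open Trace F n isF
  open IntegersMod (2 ^ ℕ.suc (ℕ.suc j)) {{m^n≢0 2 (ℕ.suc (ℕ.suc j))}} using (_⊕_)
  open AbelianGroup (ℤ/2^ (ℕ.suc (ℕ.suc j)))
    using () renaming (identityˡ to ⊕-identityˡ; identityʳ to ⊕-identityʳ)
  open Star (ℕ.suc n) (ℕ.suc (ℕ.suc j)) F isF using (trTerm)

  private
    k = ℕ.suc (ℕ.suc j)
    𝟎 = zeroMod (2 ^ k) {{m^n≢0 2 k}}
    T = Tr (ℕ.suc n)

  trTerm-0 : ∀ {x} → T x ≈ 0# → trTerm x ≡ 𝟎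
  trTerm-0 {x} Tx≈0 with to (T x) Fin.≟ to 0#
  ... | yes _    = ≡.refl
  ... | no Tx≉0 = ⊥-elim (Tx≉0 (to-cong Tx≈0))

  trTerm-1 : ∀ {x} → T x ≈ 1# → trTerm x ≡ half k
  trTerm-1 {x} Tx≈1 with to (T x) Fin.≟ to 0#
  ... | yes Tx≈0 = ⊥-elim (1≉0 (trans (sym Tx≈1) (injective Tx≈0)))
  ... | no _     = ≡.refl

  trTerm-cong : ∀ {x y} → x ≈ y → trTerm x ≡ trTerm y
  trTerm-cong {x} {y} x≈y with Tr-0or1 x
  ... | inj₁ Tx≈0 = ≡.trans (trTerm-0 Tx≈0) (≡.sym (trTerm-0 (trans (Tr-cong (ℕ.suc n) (sym x≈y)) Tx≈0)))
  ... | inj₂ Tx≈1 = ≡.trans (trTerm-1 Tx≈1) (≡.sym (trTerm-1 (trans (Tr-cong (ℕ.suc n) (sym x≈y)) Tx≈1)))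

  private
    T+≈ : ∀ {x y a b c} → T x ≈ a → T y ≈ b → a + b ≈ c → T (x + y) ≈ c
    T+≈ {x} {y} Tx≈a Ty≈b a+b≈c = trans (Tr-+ (ℕ.suc n) x y) (trans (+-cong Tx≈a Ty≈b) a+b≈c)

    trTerm-+-by : ∀ {x y u v w} → trTerm (x + y) ≡ w → trTerm x ≡ u → trTerm y ≡ v → u ⊕ v ≡ w →
                  trTerm (x + y) ≡ trTerm x ⊕ trTerm y
    trTerm-+-by x+y↦w x↦u y↦v u⊕v≡w = ≡.trans x+y↦w (≡.sym (≡.trans (≡.cong₂ _⊕_ x↦u y↦v) u⊕v≡w))

  trTerm-+ : ∀ x y → trTerm (x + y) ≡ trTerm x ⊕ trTerm y
  trTerm-+ x y with Tr-0or1 x | Tr-0or1 y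
  ... | inj₁ Tx≈0 | inj₁ Ty≈0 =
    trTerm-+-by (trTerm-0 (T+≈ Tx≈0 Ty≈0 (+-identityˡ 0#))) (trTerm-0 Tx≈0) (trTerm-0 Ty≈0) (⊕-identityˡ 𝟎)
  ... | inj₁ Tx≈0 | inj₂ Ty≈1 =
    trTerm-+-by (trTerm-1 (T+≈ Tx≈0 Ty≈1 (+-identityˡ 1#))) (trTerm-0 Tx≈0) (trTerm-1 Ty≈1) (⊕-identityˡ _)
  ... | inj₂ Tx≈1 | inj₁ Ty≈0 =
    trTerm-+-by (trTerm-1 (T+≈ Tx≈1 Ty≈0 (+-identityʳ 1#))) (trTerm-1 Tx≈1) (trTerm-0 Ty≈0) (⊕-identityʳ _)
  ... | inj₂ Tx≈1 | inj₂ Ty≈1 =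
    trTerm-+-by (trTerm-0 (T+≈ Tx≈1 Ty≈1 (x+x≈0 1#))) (trTerm-1 Tx≈1) (trTerm-1 Ty≈1) (half-double (ℕ.suc j))

  traceForm : Carrier → Carrier → Z2^ k
  traceForm x y = trTerm (x * y)

  traceForm-biadditive : IsBiadditive +-abelianGroup (ℤ/2^ k) traceForm
  traceForm-biadditive = record
    { cong  = λ x≈x′ y≈y′ → trTerm-cong (*-cong x≈x′ y≈y′)
    ; homoˡ = λ x y z → ≡.trans (trTerm-cong (distribʳ z x y)) (trTerm-+ (x * z) (y * z))
    ; homoʳ = λ x y z → ≡.trans (trTerm-cong (distribˡ x y z)) (trTerm-+ (x * y) (x * z)) }

  traceForm-sym : ∀ x y → traceForm x y ≡ traceForm y x
  traceForm-sym x y = trTerm-cong (*-comm x y)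

  diagonalHalf : Carrier → Z2^ k
  diagonalHalf x with T (x * x) ≟ 0#
  ... | yes _ = 𝟎
  ... | no  _ = quarter j

  diagonalHalf-double : ∀ x → diagonalHalf x ⊕ diagonalHalf x ≡ traceForm x x
  diagonalHalf-double x with T (x * x) ≟ 0#
  ... | yes Txx≈0 = ≡.trans (⊕-identityˡ 𝟎) (≡.sym (trTerm-0 Txx≈0))
  ... | no Txx≉0  = ≡.trans (quarter-double j) (≡.sym (trTerm-1 ([ ⊥-elim ∘ Txx≉0 , id ]′ (Tr-0or1 (x * x)))))

proposition3p5 : {c ℓ : Level} (n k : ℕ) → 1 ≤ n → 1 < k →
    (F : CommutativeRing c ℓ) (isF : IsFiniteFieldOfSize F (2 ^ n)) →
    Σ (Star.Carrierᴳ n k F isF) (λ e →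
    Σ (Star.Carrierᴳ n k F isF → Star.Carrierᴳ n k F isF) (λ inv →
      IsGroup (Star._≈ᴳ_ n k F isF) (Star._+⋆_ n k F isF) e inv
      × Σ (Star.Carrierᴳ n k F isF → RawGroup.Carrier (Z2nZ2k n k)) (λ φ →
          GroupMorphisms.IsGroupIsomorphism
            (Star.rawG n k F isF e inv)
            (Z2nZ2k n k) φ)))
proposition3p5 ℕ.zero    _                 ()  _                 _ _
proposition3p5 (ℕ.suc n) (ℕ.suc ℕ.zero)    _   (ℕ.s≤s ())         _ _
proposition3p5 (ℕ.suc n) (ℕ.suc (ℕ.suc j)) _   _                 F isF =
  ε⋆ , _⁻¹⋆ , ⋆-isGroup , φ , φ-isGroupIsomorphism
  where
  open CommutativeRing F using (+-abelianGroup)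
  open Trace F n isF using (+-elementary)
  open TraceForm F n isF j
  open TwistedProduct +-abelianGroup (ℤ/2^ (ℕ.suc (ℕ.suc j))) traceForm-biadditive
  open Splitting +-abelianGroup +-elementary (ℕ.suc (ℕ.suc j))
                 traceForm-biadditive traceForm-sym diagonalHalf diagonalHalf-double
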